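{- For all positive integers $k$, $\textnormal{mc}(k)=\textnormal{ek}(k)$, where $\textnormal{mc}(k)$ is the maximum clique number of a graph with edge metric dimension at most $k$, and $\textnormal{ek}(k)$ is the maximum size of a family $\mathcal{F}$ of subsets of $\{1,2,\dots,k\}$ such that all pairwise unions are distinct, i.e., $A\cup B\ne C\cup D$ whenever $\{A,B\}\ne\{C,D\}$ are two different unordered pairs of distinct members of $\mathcal{F}$.
   Context: Graphs are finite, simple, undirected. For an edge $e=\{u,v\}$ and vertex $w$, $\textnormal{dist}(e,w)=\min(\textnormal{dist}(w,u),\textnormal{dist}(w,v))$. A set $S=\{v_1,\dots,v_k\}$ of vertices is an edge resolving set of $G$ if the vectors $(\textnormal{dist}(e,v_1),\dots,\textnormal{dist}(e,v_k))$ are pairwise distinct over all edges $e$; the edge metric dimension $\textnormal{edim}(G)$ is the minimum size of an edge resolving set. -}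

module Defs where

open import Level using (0ℓ)
open import Data.Nat using (ℕ; zero; suc; _≤_; _⊓_)
open import Data.Fin using (Fin; _<_)
open import Data.Fin.Subset using (Subset; _∪_)
open import Data.Product using (Σ; ∃; _×_; _,_)
open import Data.Sum using (_⊎_)
open import Relation.Nullary using (¬_)
open import Relation.Binary.PropositionalEquality using (_≡_; _≢_)
open import Function.Definitions using (Injective)

record Graph (n : ℕ) : Set₁ where
  field
    Adj     : Fin n → Fin n → Set
    sym     : ∀ {u v} → Adj u v → Adj v u
    irrefl  : ∀ {u} → ¬ Adj u u
open Graph public

data Walk {n : ℕ} (G : Graph n) : Fin n → Fin n → ℕ → Set where
  here : ∀ {u} → Walk G u u zero
  step : ∀ {u w v d} → Adj G u w → Walk G w v d → Walk G u v (suc d)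

Connected : ∀ {n} → Graph n → Set
Connected {n} G = ∀ (u v : Fin n) → ∃ λ d → Walk G u v d

IsDist : ∀ {n} → Graph n → Fin n → Fin n → ℕ → Set
IsDist G u v d = Walk G u v d × (∀ m → Walk G u v m → d ≤ m)

-- An edge {u,v} is represented canonically by (u , v) with u < v and Adj u v.
Edge : ∀ {n} → Graph n → Set
Edge {n} G = Σ (Fin n) λ u → Σ (Fin n) λ v → (u < v) × Adj G u v

ends : ∀ {n} {G : Graph n} → Edge G → Fin n × Fin n
ends (u , v , _ , _) = u , v

EdgeDist : ∀ {n} (G : Graph n) → Fin n × Fin n → Fin n → ℕ → Set
EdgeDist G (u , v) w d =
  ∃ λ du → ∃ λ dv → IsDist G w u du × IsDist G w v dv × d ≡ du ⊓ dv

EdgeResolving : ∀ {n m} (G : Graph n) → (Fin m → Fin n) → Set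
EdgeResolving {n} {m} G S =
  ∀ (e e' : Edge G) → ends {G = G} e ≢ ends {G = G} e' →
    ∃ λ (i : Fin m) → ∃ λ d → ∃ λ d' →
      EdgeDist G (ends {G = G} e) (S i) d × EdgeDist G (ends {G = G} e') (S i) d' × d ≢ d'

EdimAtMost : ∀ {n} → Graph n → ℕ → Set
EdimAtMost {n} G k =
  ∃ λ m → m ≤ k × Σ (Fin m → Fin n) λ S → Injective _≡_ _≡_ S × EdgeResolving G S

HasClique : ∀ {n} → Graph n → ℕ → Set
HasClique {n} G m =
  Σ (Fin m → Fin n) λ f → ∀ (i j : Fin m) → i ≢ j → Adj G (f i) (f j)

IsMC : ℕ → ℕ → Set₁
IsMC k N =
  (∃ λ n → Σ (Graph n) λ G → Connected G × EdimAtMost G k × HasClique G N)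
  × (∀ n (G : Graph n) → Connected G → EdimAtMost G k →
       ∀ m → HasClique G m → m ≤ N)

DistinctPairs : ∀ {N} → Fin N → Fin N → Fin N → Fin N → Set
DistinctPairs i j i' j' = ¬ ((i ≡ i' × j ≡ j') ⊎ (i ≡ j' × j ≡ i'))

UnionDistinct : ∀ {N} (k : ℕ) → (Fin N → Subset k) → Set
UnionDistinct {N} k F =
  Injective _≡_ _≡_ F ×
  (∀ (i j i' j' : Fin N) → i ≢ j → i' ≢ j' → DistinctPairs i j i' j' →
     F i ∪ F j ≢ F i' ∪ F j')

IsEK : ℕ → ℕ → Set
IsEK k N =
  (Σ (Fin N → Subset k) λ F → UnionDistinct k F)
  × (∀ m (F : Fin m → Subset k) → UnionDistinct k F → m ≤ N)

module Submission where

open import Defs hiding (sym)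
open import Level using (0ℓ)
open import Data.Nat as ℕ using (ℕ; zero; suc; _≤_; _<_; _⊓_; _^_; z≤n; s≤s)
open import Data.Nat.Properties as ℕ using (≤-refl; ≤-trans)
open import Data.Nat.Induction using (<-rec)
open import Data.Fin as Fin using (Fin; zero; suc; combine)
open import Data.Fin.Properties as Fin using (any?; all?; _≟_)
open import Data.Fin.Subset using (Subset; _∪_; ⁅_⁆) renaming (⊥ to ∅)
open import Data.Fin.Subset.Properties using (anySubset?; ∪-identityˡ; ∪-idem; ∪-commutativeMonoid)
open import Algebra.Bundles using (CommutativeMonoid)
import Algebra.Properties.CommutativeSemigroup as CommutativeSemigroup
open import Data.Vec as Vec using (Vec; []; _∷_; lookup; tabulate)
open import Data.Vec.Properties as Vec using (lookup∘tabulate)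
open import Data.Bool as Bool using (Bool; true; false; if_then_else_)
open import Data.Bool.Properties using (∨-zeroʳ)
open import Data.Product using (Σ; ∃; _×_; _,_; proj₁; proj₂)
open import Data.Sum using (_⊎_; inj₁; inj₂)
import Data.Empty as Empty
open import Relation.Binary.Definitions using (DecidableEquality; tri<; tri≈; tri>)
open import Relation.Nullary using (¬_; Dec; does; yes; no; map′; contradiction)
open import Relation.Nullary.Negation using (¬¬-map)
open import Relation.Nullary.Decidable using (decidable-stable; _×-dec_; _⊎-dec_; _→-dec_; ¬?)
open import Relation.Unary using (Pred; Decidable)
open import Relation.Binary.PropositionalEquality
open import Function using (_∘_; flip)
open import Function.Definitions using (Injective)

-- The distances from a landmark s to the vertices of a clique take at most two consecutive
-- values μ and μ + 1, and the distance from s to an edge uv of the clique is μ exactly when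
-- u or v is at distance μ. So if S = {s₁, …, sₚ} resolves the edges, the sets
-- {s ∈ S : d(s, v) = μₛ} (v in the clique) have pairwise distinct unions, and the clique has
-- at most ek(k) vertices. Conversely, a union-distinct family F is realised by a clique on its
-- members together with one landmark per coordinate j, adjacent to the members containing j:
-- the landmarks resolve the edges. Graph distances only exist classically here, which is
-- harmless because the bound m ≤ ek(k) being proved is decidable.

_≐_ : ∀ {A : Set} → A × A → A × A → Set
(x , y) ≐ (x′ , y′) = (x ≡ x′ × y ≡ y′) ⊎ (x ≡ y′ × y ≡ x′)

≐-sym : ∀ {A : Set} {p q : A × A} → p ≐ q → q ≐ p
≐-sym (inj₁ (refl , refl)) = inj₁ (refl , refl)
≐-sym (inj₂ (refl , refl)) = inj₂ (refl , refl)

≐-swap : ∀ {A : Set} {x y : A} → (x , y) ≐ (y , x)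
≐-swap = inj₂ (refl , refl)

≐-map : ∀ {A B : Set} (f : A → B) {x y x′ y′} → (x , y) ≐ (x′ , y′) → (f x , f y) ≐ (f x′ , f y′)
≐-map f (inj₁ (refl , refl)) = inj₁ (refl , refl)
≐-map f (inj₂ (refl , refl)) = inj₂ (refl , refl)

≐-trans : ∀ {A : Set} {p q r : A × A} → p ≐ q → q ≐ r → p ≐ r
≐-trans (inj₁ (refl , refl)) q≐r                  = q≐r
≐-trans (inj₂ (refl , refl)) (inj₁ (refl , refl)) = inj₂ (refl , refl)
≐-trans (inj₂ (refl , refl)) (inj₂ (refl , refl)) = inj₁ (refl , refl)

≐-injective : ∀ {A B : Set} {f : A → B} → Injective _≡_ _≡_ f →
              ∀ {x y x′ y′} → (f x , f y) ≐ (f x′ , f y′) → (x , y) ≐ (x′ , y′)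
≐-injective f-inj (inj₁ (eq₁ , eq₂)) = inj₁ (f-inj eq₁ , f-inj eq₂)
≐-injective f-inj (inj₂ (eq₁ , eq₂)) = inj₂ (f-inj eq₁ , f-inj eq₂)

PairUnionsDistinct : ∀ {m} k → (Fin m → Subset k) → Set
PairUnionsDistinct k F =
  ∀ i j i′ j′ → i ≢ j → i′ ≢ j′ → DistinctPairs i j i′ j′ → F i ∪ F j ≢ F i′ ∪ F j′

UnionDistinctFamily : ℕ → ℕ → Set
UnionDistinctFamily k m = Σ (Fin m → Subset k) (UnionDistinct k)

avoid-two : ∀ {r} (a b : Fin (3 ℕ.+ r)) → ∃ λ c → c ≢ a × c ≢ b
avoid-two a b with zero ≟ a | zero ≟ b
... | no z≢a | no z≢b = zero , z≢a , z≢b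
... | yes refl | _ with suc zero ≟ b
...   | no o≢b  = suc zero , (λ ()) , o≢b
...   | yes refl = suc (suc zero) , (λ ()) , (λ ())
avoid-two a b | no _ | yes refl with suc zero ≟ a
...   | no o≢a  = suc zero , o≢a , (λ ())
...   | yes refl = suc (suc zero) , (λ ()) , (λ ())

-- With a third member c, F a ≡ F b would give F a ∪ F c ≡ F b ∪ F c.
pairUnionsDistinct⇒injective : ∀ {m k} {F : Fin m → Subset k} → 3 ≤ m →
                               PairUnionsDistinct k F → Injective _≡_ _≡_ F
pairUnionsDistinct⇒injective {F = F} (s≤s (s≤s (s≤s _))) distinct {a} {b} Fa≡Fb with a ≟ b
... | yes a≡b = a≡b
... | no a≢b with avoid-two a b
...   | c , c≢a , c≢b =
  contradiction (cong (_∪ F c) Fa≡Fb)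
    (distinct a c b c (c≢a ∘ sym) (c≢b ∘ sym)
      λ { (inj₁ (a≡b , _)) → a≢b a≡b ; (inj₂ (a≡c , _)) → c≢a (sym a≡c) })

UnionDistinct-cong : ∀ {m k} {F G : Fin m → Subset k} → (∀ i → F i ≡ G i) →
                     UnionDistinct k F → UnionDistinct k G
UnionDistinct-cong {F = F} {G} F≗G (injective , distinct) =
  (λ {x} {y} Gx≡Gy → injective (trans (F≗G x) (trans Gx≡Gy (sym (F≗G y))))) ,
  λ i j i′ j′ i≢j i′≢j′ ij≠i′j′ eq → distinct i j i′ j′ i≢j i′≢j′ ij≠i′j′
    (trans (cong₂ _∪_ (F≗G i) (F≗G j)) (trans eq (sym (cong₂ _∪_ (F≗G i′) (F≗G j′)))))

UnionDistinct-map : ∀ {m p k} {F : Fin m → Subset p} (h : Subset p → Subset k) →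
                    Injective _≡_ _≡_ h → (∀ A B → h (A ∪ B) ≡ h A ∪ h B) →
                    UnionDistinct p F → UnionDistinct k (h ∘ F)
UnionDistinct-map {F = F} h h-injective h-∪ (injective , distinct) =
  injective ∘ h-injective ,
  λ i j i′ j′ i≢j i′≢j′ ij≠i′j′ eq → distinct i j i′ j′ i≢j i′≢j′ ij≠i′j′
    (h-injective (trans (h-∪ (F i) (F j)) (trans eq (sym (h-∪ (F i′) (F j′))))))

pad : ∀ {p k} → p ≤ k → Subset p → Subset k
pad z≤n      []      = ∅
pad (s≤s p≤k) (x ∷ A) = x ∷ pad p≤k A

pad-injective : ∀ {p k} (p≤k : p ≤ k) → Injective _≡_ _≡_ (pad p≤k)
pad-injective z≤n       {[]}    {[]}    _  = refl
pad-injective (s≤s p≤k) {x ∷ A} {y ∷ B} eq =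
  cong₂ _∷_ (Vec.∷-injectiveˡ eq) (pad-injective p≤k (Vec.∷-injectiveʳ eq))

pad-∪ : ∀ {p k} (p≤k : p ≤ k) A B → pad p≤k (A ∪ B) ≡ pad p≤k A ∪ pad p≤k B
pad-∪ z≤n [] [] = sym (∪-identityˡ ∅)
pad-∪ (s≤s p≤k) (x ∷ A) (y ∷ B) = cong ((x Bool.∨ y) ∷_) (pad-∪ p≤k A B)

UnionDistinctFamily-mono : ∀ {p k m} → p ≤ k → UnionDistinctFamily p m → UnionDistinctFamily k m
UnionDistinctFamily-mono p≤k (F , ud) =
  pad p≤k ∘ F , UnionDistinct-map (pad p≤k) (pad-injective p≤k) (pad-∪ p≤k) ud

emptyFamily : ∀ {k} → UnionDistinctFamily k 0
emptyFamily = (λ ()) , (λ { {()} }) , λ ()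

fin2-pairs : (i j i′ j′ : Fin 2) → i ≢ j → i′ ≢ j′ → (i , j) ≐ (i′ , j′)
fin2-pairs zero       zero       _          _          i≢j _     = contradiction refl i≢j
fin2-pairs (suc zero) (suc zero) _          _          i≢j _     = contradiction refl i≢j
fin2-pairs _          _          zero       zero       _   i′≢j′ = contradiction refl i′≢j′
fin2-pairs _          _          (suc zero) (suc zero) _   i′≢j′ = contradiction refl i′≢j′
fin2-pairs zero       (suc zero) zero       (suc zero) _ _ = inj₁ (refl , refl)
fin2-pairs zero       (suc zero) (suc zero) zero       _ _ = inj₂ (refl , refl)
fin2-pairs (suc zero) zero       zero       (suc zero) _ _ = inj₂ (refl , refl)
fin2-pairs (suc zero) zero       (suc zero) zero       _ _ = inj₁ (refl , refl)

twoMemberFamily : ∀ {k} → 1 ≤ k → UnionDistinctFamily k 2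
twoMemberFamily {suc k} _ = F , injective , λ i j i′ j′ i≢j i′≢j′ ij≠i′j′ _ →
  ij≠i′j′ (fin2-pairs i j i′ j′ i≢j i′≢j′)
  where
  F : Fin 2 → Subset (suc k)
  F zero       = ∅
  F (suc zero) = ⁅ zero ⁆
  injective : Injective _≡_ _≡_ F
  injective {zero}     {zero}     _ = refl
  injective {suc zero} {suc zero} _ = refl
  injective {zero}     {suc zero} ()
  injective {suc zero} {zero}     ()

Exhaustible : Set → Set₁
Exhaustible A = ∀ {P : Pred A 0ℓ} → Decidable P → Dec (∃ P)

anyVec? : ∀ {A} → Exhaustible A → ∀ {m} → Exhaustible (Vec A m)
anyVec? anyA? {zero} P? = map′ ([] ,_) (λ { ([] , p) → p }) (P? [])
anyVec? anyA? {suc m} P? =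
  map′ (λ (x , xs , p) → x ∷ xs , p) (λ { (x ∷ xs , p) → x , xs , p })
       (anyA? λ x → anyVec? anyA? λ xs → P? (x ∷ xs))

unionDistinct? : ∀ {m} k (F : Fin m → Subset k) → Dec (UnionDistinct k F)
unionDistinct? k F = map′ (λ inj → λ {x} {y} → inj x y) (λ inj x y → inj {x} {y}) injective?
                     ×-dec distinct?
  where
  _≟ˢ_ : DecidableEquality (Subset k)
  _≟ˢ_ = Vec.≡-dec Bool._≟_
  injective? : Dec (∀ x y → F x ≡ F y → x ≡ y)
  injective? = all? λ x → all? λ y → (F x ≟ˢ F y) →-dec (x ≟ y)
  distinct? : Dec (PairUnionsDistinct k F)
  distinct? = all? λ i → all? λ j → all? λ i′ → all? λ j′ →
    ¬? (i ≟ j) →-dec ¬? (i′ ≟ j′) →-dec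
    ¬? (((i ≟ i′) ×-dec (j ≟ j′)) ⊎-dec ((i ≟ j′) ×-dec (j ≟ i′))) →-dec
    ¬? ((F i ∪ F j) ≟ˢ (F i′ ∪ F j′))

unionDistinctFamily? : ∀ k m → Dec (UnionDistinctFamily k m)
unionDistinctFamily? k m =
  map′ (λ (v , ud) → lookup v , ud)
       (λ (F , ud) → tabulate F , UnionDistinct-cong (λ i → sym (lookup∘tabulate F i)) ud)
       (anyVec? anySubset? (unionDistinct? k ∘ lookup))

bit : Bool → Fin 2
bit false = zero
bit true  = suc zero

bit-injective : Injective _≡_ _≡_ bit
bit-injective {false} {false} _ = refl
bit-injective {true}  {true}  _ = refl

encode : ∀ {k} → Subset k → Fin (2 ^ k)
encode []      = zero
encode (x ∷ A) = combine (bit x) (encode A)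

encode-injective : ∀ {k} → Injective _≡_ _≡_ (encode {k})
encode-injective {x = []}    {[]}    _  = refl
encode-injective {x = x ∷ A} {y ∷ B} eq with Fin.combine-injective (bit x) (encode A) (bit y) (encode B) eq
... | x≡y , A≡B = cong₂ _∷_ (bit-injective x≡y) (encode-injective A≡B)

UnionDistinctFamily⇒≤2^ : ∀ {k m} → UnionDistinctFamily k m → m ≤ 2 ^ k
UnionDistinctFamily⇒≤2^ (_ , injective , _) = Fin.injective⇒≤ (injective ∘ encode-injective)

bounded-maximum : ∀ {P : Pred ℕ 0ℓ} → Decidable P → P 0 → ∀ B → (∀ m → P m → m ≤ B) →
                  ∃ λ N → P N × (∀ m → P m → m ≤ N)
bounded-maximum P? p₀ zero    bounded = 0 , p₀ , bounded
bounded-maximum P? p₀ (suc B) bounded with P? (suc B)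
... | yes p = suc B , p , bounded
... | no ¬p = bounded-maximum P? p₀ B λ m pm → ℕ.≤-pred (ℕ.≤∧≢⇒< (bounded m pm) λ { refl → ¬p pm })

ek-exists : ∀ k → ∃ (IsEK k)
ek-exists k with bounded-maximum (unionDistinctFamily? k) emptyFamily (2 ^ k) (λ _ → UnionDistinctFamily⇒≤2^)
... | N , family , maximal = N , family , λ m F ud → maximal m (F , ud)

¬¬-minimum : ∀ (P : ℕ → Set) {d} → P d → ¬ ¬ (∃ λ n → P n × ∀ m → P m → n ≤ m)
¬¬-minimum P {d} pd ¬minimum = <-rec (λ d → ¬ P d) noneBelow d pd
  where
  noneBelow : ∀ d → (∀ {m} → m < d → ¬ P m) → ¬ P d
  noneBelow d ¬below pd = ¬minimum (d , pd , λ m pm → ℕ.≮⇒≥ λ m<d → ¬below m<d pm)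

¬¬-Π : ∀ {m} {P : Fin m → Set} → (∀ i → ¬ ¬ P i) → ¬ ¬ (∀ i → P i)
¬¬-Π {zero}  _    ¬all = ¬all λ ()
¬¬-Π {suc m} ¬¬Pi ¬all = ¬¬Pi zero λ p₀ → ¬¬-Π (¬¬Pi ∘ suc) λ ps → ¬all (Fin.∀-cons p₀ ps)

module _ {n : ℕ} {G : Graph n} where

  snoc : ∀ {u v w d} → Walk G u v d → Adj G v w → Walk G u w (suc d)
  snoc here         v~w = step v~w here
  snoc (step u~x p) v~w = step u~x (snoc p v~w)

  reverse : ∀ {u v d} → Walk G u v d → Walk G v u d
  reverse here         = here
  reverse (step u~x p) = snoc (reverse p) (Graph.sym G u~x)

  _++ʷ_ : ∀ {u v w d e} → Walk G u v d → Walk G v w e → Walk G u w (d ℕ.+ e)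
  here       ++ʷ q = q
  step u~x p ++ʷ q = step u~x (p ++ʷ q)

module _ {n : ℕ} (G : Graph n) where

  IsDist-unique : ∀ {u v d d′} → IsDist G u v d → IsDist G u v d′ → d ≡ d′
  IsDist-unique (p , shortest) (p′ , shortest′) = ℕ.≤-antisym (shortest _ p′) (shortest′ _ p)

  IsDist-adjacent : ∀ {w u v du dv} → IsDist G w u du → IsDist G w v dv → Adj G u v → dv ≤ suc du
  IsDist-adjacent (p , _) (_ , shortest) u~v = shortest _ (snoc p u~v)

  ¬¬-IsDist : Connected G → ∀ u v → ¬ ¬ ∃ (IsDist G u v)
  ¬¬-IsDist connected u v = ¬¬-minimum (Walk G u v) (proj₂ (connected u v))

  -- δ is a breadth-first layering from w.
  module _ (w : Fin n) (δ : Fin n → ℕ)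
           (δ-zero : ∀ v → δ v ≡ 0 → v ≡ w) (δ-root : δ w ≡ 0)
           (δ-parent : ∀ v d → δ v ≡ suc d → ∃ λ u → Adj G u v × δ u ≡ d)
           (δ-adjacent : ∀ u v → Adj G u v → δ v ≤ suc (δ u)) where

    layer-walk : ∀ d v → δ v ≡ d → Walk G w v d
    layer-walk zero    v δv≡0 = subst (λ x → Walk G w x 0) (sym (δ-zero v δv≡0)) here
    layer-walk (suc d) v δv≡1+d with δ-parent v d δv≡1+d
    ... | u , u~v , δu≡d = snoc (layer-walk d u δu≡d) u~v

    layer-≤ : ∀ {x v m} → Walk G x v m → δ v ≤ δ x ℕ.+ m
    layer-≤ {x} here = ℕ.m≤m+n (δ x) 0
    layer-≤ {x} {v} {suc m} (step {w = y} x~y p) = begin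
      δ v               ≤⟨ layer-≤ p ⟩
      δ y ℕ.+ m         ≤⟨ ℕ.+-monoˡ-≤ m (δ-adjacent x y x~y) ⟩
      suc (δ x) ℕ.+ m   ≡⟨ sym (ℕ.+-suc (δ x) m) ⟩
      δ x ℕ.+ suc m     ∎
      where open ℕ.≤-Reasoning

    layer-IsDist : ∀ v → IsDist G w v (δ v)
    layer-IsDist v = layer-walk (δ v) v refl ,
                     λ m p → subst (λ x → δ v ≤ x ℕ.+ m) δ-root (layer-≤ p)

  edgeBetween : ∀ {x y} → Adj G x y → Σ (Edge G) λ e → ends {G = G} e ≐ (x , y)
  edgeBetween {x} {y} x~y with Fin.<-cmp x y
  ... | tri< x<y _ _ = (x , y , x<y , x~y) , inj₁ (refl , refl)
  ... | tri≈ _ refl _ = contradiction x~y (irrefl G)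
  ... | tri> _ _ y<x = (y , x , y<x , Graph.sym G x~y) , inj₂ (refl , refl)

  EdgeDist-≐ : ∀ {p q w d} → p ≐ q → EdgeDist G p w d → EdgeDist G q w d
  EdgeDist-≐ (inj₁ (refl , refl)) ed = ed
  EdgeDist-≐ (inj₂ (refl , refl)) (du , dv , u-dist , v-dist , refl) =
    dv , du , v-dist , u-dist , ℕ.⊓-comm du dv

  ends-≐ : ∀ (e e′ : Edge G) → ends {G = G} e ≐ ends {G = G} e′ → ends {G = G} e ≡ ends {G = G} e′
  ends-≐ _ _ (inj₁ (refl , refl)) = refl
  ends-≐ (_ , _ , u<v , _) (_ , _ , u′<v′ , _) (inj₂ (refl , refl)) = contradiction u′<v′ (Fin.<-asym u<v)

  EdgeDist-unique : ∀ {u v w d du dv} → EdgeDist G (u , v) w d →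
                    IsDist G w u du → IsDist G w v dv → d ≡ du ⊓ dv
  EdgeDist-unique (_ , _ , u-dist , v-dist , refl) u-dist′ v-dist′ =
    cong₂ _⊓_ (IsDist-unique u-dist u-dist′) (IsDist-unique v-dist v-dist′)

-- A clique in a graph with an edge resolving set yields a union-distinct family
argmin : ∀ {m} (g : Fin (suc m) → ℕ) → ∃ λ i → ∀ j → g i ≤ g j
argmin {zero}  g = zero , λ { zero → ≤-refl }
argmin {suc m} g with argmin (g ∘ suc)
... | i , minimal with g zero ℕ.≤? g (suc i)
...   | yes g₀≤ = zero , λ { zero → ≤-refl ; (suc j) → ≤-trans g₀≤ (minimal j) }
...   | no g₀≰ = suc i , λ { zero → ℕ.<⇒≤ (ℕ.≰⇒> g₀≰) ; (suc j) → minimal j }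

level : ℕ → Bool → ℕ
level u b = if b then u else suc u

level-⊓ : ∀ u b c → level u b ⊓ level u c ≡ level u (b Bool.∨ c)
level-⊓ u true  true  = ℕ.⊓-idem u
level-⊓ u true  false = ℕ.m≤n⇒m⊓n≡m (ℕ.n≤1+n u)
level-⊓ u false true  = ℕ.m≥n⇒m⊓n≡n (ℕ.n≤1+n u)
level-⊓ u false false = ℕ.⊓-idem (suc u)

level-positive : ∀ u b → level (suc u) b ≢ 0
level-positive u true  = ℕ.1+n≢0
level-positive u false = ℕ.1+n≢0

level-injective : ∀ u {b c} → level u b ≡ level u c → b ≡ c
level-injective u {true}  {true}  _  = refl
level-injective u {false} {false} _  = refl
level-injective u {true}  {false} eq = contradiction (sym eq) ℕ.1+n≢n
level-injective u {false} {true}  eq = contradiction eq ℕ.1+n≢n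

level-≥ : ∀ u b → u ≤ level u b
level-≥ u true  = ≤-refl
level-≥ u false = ℕ.n≤1+n u

level-≤ : ∀ u b → level u b ≤ suc u
level-≤ u true  = ℕ.n≤1+n u
level-≤ u false = ≤-refl

level-does : ∀ {a u} (a≟u : Dec (a ≡ u)) → a ≡ u ⊎ a ≡ suc u → a ≡ level u (does a≟u)
level-does (yes a≡u) _             = a≡u
level-does (no a≢u)  (inj₁ a≡u)   = contradiction a≡u a≢u
level-does (no _)    (inj₂ a≡1+u) = a≡1+u

module NearestLandmarks {n p m} (G : Graph n) (S : Fin p → Fin n) (resolving : EdgeResolving G S)
                        (f : Fin (suc m) → Fin n) (clique : ∀ i j → i ≢ j → Adj G (f i) (f j))
                        (dist : ∀ s i → ∃ (IsDist G (S s) (f i))) where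

  D : Fin p → Fin (suc m) → ℕ
  D s i = proj₁ (dist s i)

  μ : Fin p → ℕ
  μ s = D s (proj₁ (argmin (D s)))

  D-range : ∀ s i → D s i ≡ μ s ⊎ D s i ≡ suc (μ s)
  D-range s i with argmin (D s)
  ... | i₀ , minimal with i₀ ≟ i
  ...   | yes refl = inj₁ refl
  ...   | no i₀≢i with ℕ.m≤n⇒m<n∨m≡n (minimal i)
  ...     | inj₂ μ≡D = inj₁ (sym μ≡D)
  ...     | inj₁ μ<D = inj₂ (ℕ.≤-antisym (IsDist-adjacent G (proj₂ (dist s i₀)) (proj₂ (dist s i)) (clique i₀ i i₀≢i)) μ<D)

  near : Fin (suc m) → Subset p
  near i = tabulate λ s → does (D s i ℕ.≟ μ s)

  D-level : ∀ s i → D s i ≡ level (μ s) (lookup (near i) s)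
  D-level s i = trans (level-does (D s i ℕ.≟ μ s) (D-range s i))
                      (cong (level (μ s)) (sym (lookup∘tabulate (λ s → does (D s i ℕ.≟ μ s)) s)))

  f-injective : Injective _≡_ _≡_ f
  f-injective {i} {j} fi≡fj with i ≟ j
  ... | yes i≡j = i≡j
  ... | no i≢j = contradiction (subst (Adj G (f i)) (sym fi≡fj) (clique i j i≢j)) (irrefl G)

  edgeDist-level : ∀ {i j} (i≢j : i ≢ j) s {d} →
                   EdgeDist G (ends {G = G} (proj₁ (edgeBetween G (clique i j i≢j)))) (S s) d →
                   d ≡ level (μ s) (lookup (near i ∪ near j) s)
  edgeDist-level {i} {j} i≢j s {d} ed = begin
    d
      ≡⟨ EdgeDist-unique G (EdgeDist-≐ G e≐ij ed) (proj₂ (dist s i)) (proj₂ (dist s j)) ⟩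
    D s i ⊓ D s j
      ≡⟨ cong₂ _⊓_ (D-level s i) (D-level s j) ⟩
    level (μ s) (lookup (near i) s) ⊓ level (μ s) (lookup (near j) s)
      ≡⟨ level-⊓ (μ s) _ _ ⟩
    level (μ s) (lookup (near i) s Bool.∨ lookup (near j) s)
      ≡⟨ cong (level (μ s)) (sym (Vec.lookup-zipWith Bool._∨_ s (near i) (near j))) ⟩
    level (μ s) (lookup (near i ∪ near j) s)
      ∎
    where
    open ≡-Reasoning
    e≐ij : ends {G = G} (proj₁ (edgeBetween G (clique i j i≢j))) ≐ (f i , f j)
    e≐ij = proj₂ (edgeBetween G (clique i j i≢j))

  near-pairUnionsDistinct : PairUnionsDistinct p near
  near-pairUnionsDistinct i j i′ j′ i≢j i′≢j′ ij≠i′j′ unions≡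
    with resolving (proj₁ e) (proj₁ e′) ends≢
    where
    e : Σ (Edge G) λ e → ends {G = G} e ≐ (f i , f j)
    e = edgeBetween G (clique i j i≢j)
    e′ : Σ (Edge G) λ e′ → ends {G = G} e′ ≐ (f i′ , f j′)
    e′ = edgeBetween G (clique i′ j′ i′≢j′)
    ends≢ : ends {G = G} (proj₁ e) ≢ ends {G = G} (proj₁ e′)
    ends≢ ends≡ = ij≠i′j′ (≐-injective f-injective
      (≐-trans (≐-sym (proj₂ e)) (subst (_≐ (f i′ , f j′)) (sym ends≡) (proj₂ e′))))
  ... | s , d , d′ , ed , ed′ , d≢d′ =
    d≢d′ (trans (edgeDist-level i≢j s ed)
           (trans (cong (λ A → level (μ s) (lookup A s)) unions≡) (sym (edgeDist-level i′≢j′ s ed′))))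

clique⇒family : ∀ {n p m} (G : Graph n) (S : Fin p → Fin n) → EdgeResolving G S → 3 ≤ m →
                (f : Fin m → Fin n) → (∀ i j → i ≢ j → Adj G (f i) (f j)) →
                (∀ s i → ∃ (IsDist G (S s) (f i))) → UnionDistinctFamily p m
clique⇒family G S resolving 3≤m@(s≤s _) f clique dist =
  near , pairUnionsDistinct⇒injective 3≤m near-pairUnionsDistinct , near-pairUnionsDistinct
  where open NearestLandmarks G S resolving f clique dist

mc≤ek : ∀ {k N} → 1 ≤ k → IsEK k N → ∀ n (G : Graph n) → Connected G → EdimAtMost G k →
        ∀ m → HasClique G m → m ≤ N
mc≤ek {k} {N} 1≤k (_ , maximal) n G connected (p , p≤k , S , _ , resolving) m (f , clique)
  with m ℕ.≤? 2
... | yes m≤2 = ≤-trans m≤2 (maximal 2 _ (proj₂ (twoMemberFamily 1≤k)))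
... | no m≰2 = decidable-stable (m ℕ.≤? N) (¬¬-map bound distances)
  where
  distances : ¬ ¬ (∀ s i → ∃ (IsDist G (S s) (f i)))
  distances = ¬¬-Π λ s → ¬¬-Π λ i → ¬¬-IsDist G connected (S s) (f i)
  bound : (∀ s i → ∃ (IsDist G (S s) (f i))) → m ≤ N
  bound dist = let F , ud = UnionDistinctFamily-mono p≤k (clique⇒family G S resolving (ℕ.≰⇒> m≰2) f clique dist)
               in maximal m F ud

-- Every union-distinct family is realised by a clique with landmarks
Disjoint : ∀ {k} → Subset k → Subset k → Set
Disjoint {k} A C = ∀ (j : Fin k) → lookup A j ≡ true → lookup C j ≡ false

Disjoint-∪ : ∀ {k} {A B C : Subset k} → Disjoint A C → Disjoint B C → Disjoint (A ∪ B) C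
Disjoint-∪ {A = A} {B} A⊥C B⊥C j A∪B[j] with lookup A j in A[j]
... | true  = A⊥C j A[j]
... | false = B⊥C j (trans (cong (Bool._∨ lookup B j) (sym A[j]))
                          (trans (sym (Vec.lookup-zipWith Bool._∨_ j A B)) A∪B[j]))

∨-cancelʳ : ∀ {x y c} → (x ≡ true → c ≡ false) → (y ≡ true → c ≡ false) → x Bool.∨ c ≡ y Bool.∨ c → x ≡ y
∨-cancelʳ {false} {false} _   _   _  = refl
∨-cancelʳ {true}  {true}  _   _   _  = refl
∨-cancelʳ {true}  {false} x⊥c _   eq = contradiction (trans eq (x⊥c refl)) λ ()
∨-cancelʳ {false} {true}  _   y⊥c eq = contradiction (trans (sym eq) (y⊥c refl)) λ ()

∪-cancelʳ : ∀ {k} {A B C : Subset k} → Disjoint A C → Disjoint B C → A ∪ C ≡ B ∪ C → A ≡ B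
∪-cancelʳ {A = []}    {[]}    {[]}    _   _   _  = refl
∪-cancelʳ {A = x ∷ A} {y ∷ B} {c ∷ C} A⊥C B⊥C eq =
  cong₂ _∷_ (∨-cancelʳ (A⊥C zero) (B⊥C zero) (Vec.∷-injectiveˡ eq))
            (∪-cancelʳ (A⊥C ∘ suc) (B⊥C ∘ suc) (Vec.∷-injectiveʳ eq))

-- A coordinate in no member would give an isolated landmark below; adding all uncovered
-- coordinates to every member avoids this without merging any unions.
module Saturate {N k} (F : Fin N → Subset k) where

  covered? : ∀ j → Dec (∃ λ i → lookup (F i) j ≡ true)
  covered? j = any? λ i → lookup (F i) j Bool.≟ true

  uncovered : Subset k
  uncovered = tabulate λ j → Bool.not (does (covered? j))

  lookup-uncovered : ∀ j → lookup uncovered j ≡ Bool.not (does (covered? j))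
  lookup-uncovered = lookup∘tabulate _

  member⊥uncovered : ∀ i → Disjoint (F i) uncovered
  member⊥uncovered i j F[i,j] with covered? j | lookup-uncovered j
  ... | yes _   | C[j] = C[j]
  ... | no ¬cov | _    = contradiction (i , F[i,j]) ¬cov

  union⊥uncovered : ∀ i l → Disjoint (F i ∪ F l) uncovered
  union⊥uncovered i l = Disjoint-∪ {A = F i} {F l} {uncovered} (member⊥uncovered i) (member⊥uncovered l)

  saturated : Fin N → Subset k
  saturated i = F i ∪ uncovered

  saturated-∪ : ∀ i l → saturated i ∪ saturated l ≡ (F i ∪ F l) ∪ uncovered
  saturated-∪ i l = trans (interchange (F i) uncovered (F l) uncovered)
                          (cong ((F i ∪ F l) ∪_) (∪-idem uncovered))
    where open CommutativeSemigroup (CommutativeMonoid.commutativeSemigroup (∪-commutativeMonoid k))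

  saturated-UnionDistinct : UnionDistinct k F → UnionDistinct k saturated
  saturated-UnionDistinct (injective , distinct) =
    (λ {a} {b} eq → injective (∪-cancelʳ (member⊥uncovered a) (member⊥uncovered b) eq)) ,
    λ i l i′ l′ i≢l i′≢l′ il≠i′l′ eq → distinct i l i′ l′ i≢l i′≢l′ il≠i′l′
      (∪-cancelʳ (union⊥uncovered i l) (union⊥uncovered i′ l′)
                 (trans (sym (saturated-∪ i l)) (trans eq (saturated-∪ i′ l′))))

  saturated-covers : Fin N → ∀ j → ∃ λ i → lookup (saturated i) j ≡ true
  saturated-covers i₀ j with covered? j | lookup-uncovered j
  ... | yes (i , F[i,j]) | _    = i , trans (Vec.lookup-zipWith Bool._∨_ j (F i) uncovered)
                                            (cong (Bool._∨ lookup uncovered j) F[i,j])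
  ... | no _             | C[j] = i₀ , trans (Vec.lookup-zipWith Bool._∨_ j (F i₀) uncovered)
                                            (trans (cong (lookup (F i₀) j Bool.∨_) C[j]) (∨-zeroʳ _))

lookup-≢ : ∀ {k} {A B : Subset k} → A ≢ B → ∃ λ j → lookup A j ≢ lookup B j
lookup-≢ {A = []}    {[]}    A≢B = contradiction refl A≢B
lookup-≢ {A = x ∷ A} {y ∷ B} x∷A≢y∷B with x Bool.≟ y
... | no x≢y   = zero , x≢y
... | yes refl with lookup-≢ (x∷A≢y∷B ∘ cong (x ∷_))
...   | j , A[j]≢B[j] = suc j , A[j]≢B[j]

splitAt-injective : ∀ m {n} → Injective _≡_ _≡_ (Fin.splitAt m {n})
splitAt-injective m {n} {x} {y} eq =
  trans (sym (Fin.join-splitAt m n x)) (trans (cong (Fin.join m n) eq) (Fin.join-splitAt m n y))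

landmarkDist : ∀ {P Q : Set} → Dec P → Dec Q → ℕ
landmarkDist (yes _) _       = 0
landmarkDist (no _)  (yes _) = 2
landmarkDist (no _)  (no _)  = 3

landmarkDist-≥2 : ∀ {P Q : Set} → ¬ P → (P? : Dec P) (Q? : Dec Q) → 2 ≤ landmarkDist P? Q?
landmarkDist-≥2 ¬p (yes p) _       = contradiction p ¬p
landmarkDist-≥2 ¬p (no _)  (yes _) = ≤-refl
landmarkDist-≥2 ¬p (no _)  (no _)  = ℕ.n≤1+n 2

-- From landmark j, a member is at distance 1 or 2 (according to j ∈ F i), and another
-- landmark j′ at distance 2 or 3 (according to whether some member contains both).
module CliqueWithLandmarks {N k} (F : Fin N → Subset k) (ud : UnionDistinct k F)
                           (covers : ∀ j → ∃ λ i → lookup (F i) j ≡ true) where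

  Vertex : Set
  Vertex = Fin N ⊎ Fin k

  _~_ : Vertex → Vertex → Set
  inj₁ i ~ inj₁ l = i ≢ l
  inj₁ i ~ inj₂ j = lookup (F i) j ≡ true
  inj₂ j ~ inj₁ i = lookup (F i) j ≡ true
  inj₂ _ ~ inj₂ _ = Empty.⊥

  ~-sym : ∀ a b → a ~ b → b ~ a
  ~-sym (inj₁ _) (inj₁ _) i≢l = i≢l ∘ sym
  ~-sym (inj₁ _) (inj₂ _) F[i,j] = F[i,j]
  ~-sym (inj₂ _) (inj₁ _) F[i,j] = F[i,j]

  ~-irrefl : ∀ a → ¬ a ~ a
  ~-irrefl (inj₁ _) i≢i = i≢i refl
  ~-irrefl (inj₂ _) ()

  G : Graph (N ℕ.+ k)
  G = record { Adj    = λ x y → Fin.splitAt N x ~ Fin.splitAt N y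
             ; sym    = λ {x} {y} → ~-sym (Fin.splitAt N x) (Fin.splitAt N y)
             ; irrefl = λ {x} → ~-irrefl (Fin.splitAt N x) }

  shared? : ∀ j j′ → Dec (∃ λ i → lookup (F i) j ≡ true × lookup (F i) j′ ≡ true)
  shared? j j′ = any? λ i → (lookup (F i) j Bool.≟ true) ×-dec (lookup (F i) j′ Bool.≟ true)

  δ : Fin k → Vertex → ℕ
  δ j (inj₁ i)  = level 1 (lookup (F i) j)
  δ j (inj₂ j′) = landmarkDist (j ≟ j′) (shared? j j′)

  δ-self : ∀ j → δ j (inj₂ j) ≡ 0
  δ-self j with j ≟ j
  ... | yes _   = refl
  ... | no j≢j = contradiction refl j≢j

  δ-far : ∀ {j j′} → j ≢ j′ → 2 ≤ δ j (inj₂ j′)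
  δ-far {j} {j′} j≢j′ = landmarkDist-≥2 j≢j′ (j ≟ j′) (shared? j j′)

  δ-zero : ∀ j a → δ j a ≡ 0 → a ≡ inj₂ j
  δ-zero j (inj₁ i) δ≡0 = contradiction δ≡0 (level-positive 0 _)
  δ-zero j (inj₂ j′) δ≡0 with j ≟ j′
  ... | yes refl = refl
  ... | no j≢j′ = contradiction δ≡0 (ℕ.>⇒≢ (≤-trans (s≤s z≤n) (landmarkDist-≥2 j≢j′ (no j≢j′) (shared? j j′))))

  δ-parent : ∀ j a d → δ j a ≡ suc d → ∃ λ b → b ~ a × δ j b ≡ d
  δ-parent j (inj₁ i) d δ≡1+d with lookup (F i) j in F[i,j]
  ... | true  = inj₂ j , F[i,j] , trans (δ-self j) (ℕ.suc-injective δ≡1+d)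
  ... | false with covers j
  ...   | l , F[l,j] = inj₁ l , (λ { refl → contradiction (trans (sym F[l,j]) F[i,j]) λ () }) ,
                       trans (cong (level 1) F[l,j]) (ℕ.suc-injective δ≡1+d)
  δ-parent j (inj₂ j′) d δ≡1+d with j ≟ j′ | shared? j j′
  ... | no _ | yes (i , F[i,j] , F[i,j′]) =
    inj₁ i , F[i,j′] , trans (cong (level 1) F[i,j]) (ℕ.suc-injective δ≡1+d)
  ... | no _ | no ¬shared with covers j′
  ...   | l , F[l,j′] with lookup (F l) j in F[l,j]
  ...     | true  = contradiction (l , F[l,j] , F[l,j′]) ¬shared
  ...     | false = inj₁ l , F[l,j′] , trans (cong (level 1) F[l,j]) (ℕ.suc-injective δ≡1+d)

  δ-adjacent : ∀ j a b → a ~ b → δ j b ≤ suc (δ j a)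
  δ-adjacent j (inj₁ i) (inj₁ l) _ = ≤-trans (level-≤ 1 _) (s≤s (level-≥ 1 _))
  δ-adjacent j (inj₁ i) (inj₂ j′) F[i,j′] with j ≟ j′ | shared? j j′
  ... | yes _ | _        = z≤n
  ... | no _  | yes _    = s≤s (level-≥ 1 _)
  ... | no _  | no ¬shared with lookup (F i) j in F[i,j]
  ...   | true  = contradiction (i , F[i,j] , F[i,j′]) ¬shared
  ...   | false = ≤-refl
  δ-adjacent j (inj₂ j′) (inj₁ i) F[i,j′] with j ≟ j′
  ... | yes refl = ℕ.≤-reflexive (cong (level 1) F[i,j′])
  ... | no j≢j′  = ≤-trans (level-≤ 1 _) (ℕ.m≤n⇒m≤1+n (landmarkDist-≥2 j≢j′ (no j≢j′) (shared? j j′)))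

  landmark : Fin k → Fin (N ℕ.+ k)
  landmark j = N Fin.↑ʳ j

  landmark-IsDist : ∀ j v → IsDist G (landmark j) v (δ j (Fin.splitAt N v))
  landmark-IsDist j = layer-IsDist G (landmark j) (δ j ∘ Fin.splitAt N) only-root root parent adjacent
    where
    only-root : ∀ v → δ j (Fin.splitAt N v) ≡ 0 → v ≡ landmark j
    only-root v δ≡0 = sym (Fin.splitAt⁻¹-↑ʳ (δ-zero j (Fin.splitAt N v) δ≡0))
    root : δ j (Fin.splitAt N (landmark j)) ≡ 0
    root = trans (cong (δ j) (Fin.splitAt-↑ʳ N k j)) (δ-self j)
    parent : ∀ v d → δ j (Fin.splitAt N v) ≡ suc d → ∃ λ u → Adj G u v × δ j (Fin.splitAt N u) ≡ d
    parent v d δ≡1+d with δ-parent j (Fin.splitAt N v) d δ≡1+d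
    ... | b , b~v , δb≡d = Fin.join N k b ,
                           subst (_~ Fin.splitAt N v) (sym (Fin.splitAt-join N k b)) b~v ,
                           trans (cong (δ j) (Fin.splitAt-join N k b)) δb≡d
    adjacent : ∀ u v → Adj G u v → δ j (Fin.splitAt N v) ≤ suc (δ j (Fin.splitAt N u))
    adjacent u v = δ-adjacent j (Fin.splitAt N u) (Fin.splitAt N v)

  connected : Fin k → Connected G
  connected j u v = _ , reverse (proj₁ (landmark-IsDist j u)) ++ʷ proj₁ (landmark-IsDist j v)

  members-clique : HasClique G N
  members-clique = (Fin._↑ˡ k) , λ i l i≢l →
    subst₂ _~_ (sym (Fin.splitAt-↑ˡ N i k)) (sym (Fin.splitAt-↑ˡ N l k)) i≢l

  Resolves : Vertex → Vertex → Vertex → Vertex → Set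
  Resolves a b a′ b′ = ∃ λ j → δ j a ⊓ δ j b ≢ δ j a′ ⊓ δ j b′

  δ-members : ∀ j i l → δ j (inj₁ i) ⊓ δ j (inj₁ l) ≡ level 1 (lookup (F i ∪ F l) j)
  δ-members j i l = trans (level-⊓ 1 _ _) (cong (level 1) (sym (Vec.lookup-zipWith Bool._∨_ j (F i) (F l))))

  δ-spoke : ∀ j i → δ j (inj₁ i) ⊓ δ j (inj₂ j) ≡ 0
  δ-spoke j i = trans (cong (δ j (inj₁ i) ⊓_) (δ-self j)) (ℕ.⊓-zeroʳ _)

  resolves-members : ∀ {i l i′ l′} → i ≢ l → i′ ≢ l′ → ¬ (i , l) ≐ (i′ , l′) →
                     Resolves (inj₁ i) (inj₁ l) (inj₁ i′) (inj₁ l′)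
  resolves-members {i} {l} {i′} {l′} i≢l i′≢l′ il≠i′l′
    with lookup-≢ (proj₂ ud i l i′ l′ i≢l i′≢l′ il≠i′l′)
  ... | j , unions≢ = j , λ eq →
    unions≢ (level-injective 1 (trans (sym (δ-members j i l)) (trans eq (δ-members j i′ l′))))

  resolves-member-spoke : ∀ {i l i′ j} → Resolves (inj₁ i) (inj₁ l) (inj₁ i′) (inj₂ j)
  resolves-member-spoke {i} {l} {i′} {j} =
    j , λ eq → level-positive 0 _ (trans (sym (δ-members j i l)) (trans eq (δ-spoke j i′)))

  resolves-spokes : ∀ {i j i′ j′} → lookup (F i) j ≡ true → lookup (F i′) j′ ≡ true →
                    ¬ (i ≡ i′ × j ≡ j′) → Resolves (inj₁ i) (inj₂ j) (inj₁ i′) (inj₂ j′)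
  resolves-spokes {i} {j} {i′} {j′} F[i,j] F[i′,j′] ¬same with j ≟ j′
  ... | no j≢j′ = j , λ eq → contradiction (subst (1 ≤_) (trans (sym eq) (δ-spoke j i)) far) λ ()
    where
    far : 1 ≤ δ j (inj₁ i′) ⊓ δ j (inj₂ j′)
    far = ℕ.⊓-glb (level-≥ 1 _) (≤-trans (s≤s z≤n) (δ-far j≢j′))
  ... | yes refl with lookup-≢ (λ Fi≡Fi′ → ¬same (proj₁ ud Fi≡Fi′ , refl))
  ...   | j₁ , members≢ = j₁ , λ eq →
    members≢ (level-injective 1 (trans (sym (nearer i)) (trans eq (nearer i′))))
    where
    -- Both members contain j, so they can only differ at some other landmark.
    j₁≢j : j₁ ≢ j
    j₁≢j refl = members≢ (trans F[i,j] (sym F[i′,j′]))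
    nearer : ∀ x → δ j₁ (inj₁ x) ⊓ δ j₁ (inj₂ j) ≡ δ j₁ (inj₁ x)
    nearer x = ℕ.m≤n⇒m⊓n≡m (≤-trans (level-≤ 1 _) (δ-far j₁≢j))

  data Link : Vertex → Vertex → Set where
    chord : ∀ {i l} → i ≢ l → Link (inj₁ i) (inj₁ l)
    spoke : ∀ {i j} → lookup (F i) j ≡ true → Link (inj₁ i) (inj₂ j)

  orient : ∀ a b → a ~ b → Link a b ⊎ Link b a
  orient (inj₁ _) (inj₁ _) i≢l    = inj₁ (chord i≢l)
  orient (inj₁ _) (inj₂ _) F[i,j] = inj₁ (spoke F[i,j])
  orient (inj₂ _) (inj₁ _) F[i,j] = inj₂ (spoke F[i,j])

  resolves-links : ∀ {a b a′ b′} → Link a b → Link a′ b′ → ¬ (a , b) ≐ (a′ , b′) → Resolves a b a′ b′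
  resolves-links (chord i≢l) (chord i′≢l′) distinct = resolves-members i≢l i′≢l′ (distinct ∘ ≐-map inj₁)
  resolves-links (chord _)   (spoke _)     _ = resolves-member-spoke
  resolves-links (spoke _)   (chord _)     _ with resolves-member-spoke
  ... | j , separated = j , separated ∘ sym
  resolves-links (spoke F[i,j]) (spoke F[i′,j′]) distinct =
    resolves-spokes F[i,j] F[i′,j′] λ (i≡i′ , j≡j′) → distinct (inj₁ (cong inj₁ i≡i′ , cong inj₂ j≡j′))

  Resolves-swapˡ : ∀ {a b a′ b′} → Resolves b a a′ b′ → Resolves a b a′ b′
  Resolves-swapˡ (j , separated) = j , separated ∘ trans (ℕ.⊓-comm _ _)

  Resolves-swapʳ : ∀ {a b a′ b′} → Resolves a b b′ a′ → Resolves a b a′ b′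
  Resolves-swapʳ (j , separated) = j , λ eq → separated (trans eq (ℕ.⊓-comm _ _))

  resolves : ∀ a b a′ b′ → a ~ b → a′ ~ b′ → ¬ (a , b) ≐ (a′ , b′) → Resolves a b a′ b′
  resolves a b a′ b′ a~b a′~b′ distinct with orient a b a~b | orient a′ b′ a′~b′
  ... | inj₁ L | inj₁ L′ = resolves-links L L′ distinct
  ... | inj₁ L | inj₂ L′ = Resolves-swapʳ {a} {b} {a′} {b′} (resolves-links L L′ (distinct ∘ flip ≐-trans ≐-swap))
  ... | inj₂ L | inj₁ L′ = Resolves-swapˡ {a} {b} {a′} {b′} (resolves-links L L′ (distinct ∘ ≐-trans ≐-swap))
  ... | inj₂ L | inj₂ L′ =
    Resolves-swapˡ {a} {b} {a′} {b′} (Resolves-swapʳ {b} {a} {a′} {b′} (resolves-links L L′ (distinct ∘ ≐-trans ≐-swap ∘ flip ≐-trans ≐-swap)))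

  landmarks-resolving : EdgeResolving G landmark
  landmarks-resolving e@(u , v , _ , u~v) e′@(u′ , v′ , _ , u′~v′) ends≢
    with resolves _ _ _ _ u~v u′~v′ (ends≢ ∘ ends-≐ G e e′ ∘ ≐-injective (splitAt-injective N))
  ... | j , separated = j , _ , _ , (_ , _ , landmark-IsDist j u , landmark-IsDist j v , refl) ,
                             (_ , _ , landmark-IsDist j u′ , landmark-IsDist j v′ , refl) , separated

  landmarks-edim : EdimAtMost G k
  landmarks-edim = k , ≤-refl , landmark , Fin.↑ʳ-injective N _ _ , landmarks-resolving

theorem30 : ∀ (k : ℕ) → 1 ≤ k → ∃ λ N → IsMC k N × IsEK k N
theorem30 k 1≤k with ek-exists k
... | N , ek@((F , ud) , maximal) = N , (realised , mc≤ek 1≤k ek) , ek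
  where
  0<N : 0 < N
  0<N = ≤-trans (s≤s z≤n) (maximal 2 _ (proj₂ (twoMemberFamily 1≤k)))
  open Saturate F
  open CliqueWithLandmarks saturated (saturated-UnionDistinct ud) (saturated-covers (Fin.fromℕ< 0<N))
  realised : ∃ λ n → Σ (Graph n) λ G → Connected G × EdimAtMost G k × HasClique G N
  realised = _ , G , connected (Fin.fromℕ< 1≤k) , landmarks-edim , members-clique
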